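{- Let $n\ge 2$, $\pi\in S_n$ and $r\in[n+1]$, and run the toppling process on $L_n$ starting from $\pi^{(r)}$. Then: (1) the final configuration (when no position holds two or more chips) does not depend on the choices of moves made; (2) at every step every chip lies in $L_n$, i.e. no chip leaves $L_n$; (3) in the final configuration there is exactly one chip at every position of $L_n$ except at the origin when $n$ is odd, respectively except at position $1$ when $n$ is even, which is empty.
   Context: For an integer $n\ge 2$ let $L_n=\{ -\lfloor (n+1)/2\rfloor,\dots,-1,0,1,\dots,\lfloor n/2\rfloor+1\}\subset\mathbb{Z}$; position $0$ is the origin. A configuration places chips carrying distinct integer labels at positions of $\mathbb{Z}$ (a position may hold several chips). A toppling move chooses a position $i$ holding at least two chips, chooses two chips $\alpha<\beta$ at $i$, and moves $\alpha$ to $i-1$ and $\beta$ to $i+1$. The toppling process applies toppling moves, with arbitrary (e.g. random) choices of position and pair, until no position holds two or more chips. For $\pi=(\pi_1,\dots,\pi_n)\in S_n$ and $r\in[n+1]=\{1,\dots,n+1\}$, the initial configuration $\pi^{(r)}$ has, for each $j=1,\dots,n$, one chip at position $-\lfloor (n-1)/2\rfloor+j-1$ labeled $\pi_j$ if $\pi_j<r$ and $\pi_j+1$ if $\pi_j\ge r$, and in addition a chip labeled $r$ at the origin. -}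

module Defs where

open import Data.Nat as ℕ using (ℕ; zero; suc; _/_; _%_; _∸_)
open import Data.Integer as ℤ using (ℤ; +_; -_; _-_; _≤_)
open import Data.Fin using (Fin; toℕ; punchIn; _<_)
open import Data.Fin.Permutation using (Permutation′; _⟨$⟩ʳ_)
open import Data.Vec using (Vec; lookup; _[_]≔_)
open import Data.Product using (Σ; ∃; ∃-syntax; _×_; _,_)
open import Relation.Binary.PropositionalEquality using (_≡_; _≢_)
open import Relation.Binary.Construct.Closure.ReflexiveTransitive using (Star)

-- Chips carry the distinct labels 1,…,m; label ℓ is represented by the
-- index ℓ-1 : Fin m.  A configuration assigns to every chip its position.
Config : ℕ → Set
Config m = Vec ℤ m

Step : ∀ {m} → Config m → Config m → Set
Step {m} c c' =
  ∃[ α ] ∃[ β ] ((α < β) × (lookup c α ≡ lookup c β) ×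
     (c' ≡ ((c [ α ]≔ (lookup c α - + 1)) [ β ]≔ (lookup c β ℤ.+ + 1))))

Reachable : ∀ {m} → Config m → Config m → Set
Reachable = Star Step

Stable : ∀ {m} → Config m → Set
Stable {m} c = ∀ (α β : Fin m) → α ≢ β → lookup c α ≢ lookup c β

InL : ℕ → ℤ → Set
InL n x = (- (+ ((suc n) / 2)) ≤ x) × (x ≤ + (n / 2 ℕ.+ 1))

-- the initial configuration π^(r) on the chips with labels 1..n+1
-- (π ∈ S_n as a permutation of Fin n, value π_j = toℕ (π j) + 1;
--  r ∈ [n+1] as r : Fin (n+1), value toℕ r + 1).
-- The chip of the j-th entry (j 0-indexed) sits at -⌊(n-1)/2⌋ + j and has
-- label π_j if π_j < r and π_j + 1 otherwise, i.e. index punchIn r (π j);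
-- the chip labeled r sits at the origin.
IsInitial : (n : ℕ) → Permutation′ n → Fin (suc n) → Config (suc n) → Set
IsInitial n π r c =
  (lookup c r ≡ + 0) ×
  (∀ (j : Fin n) → lookup c (punchIn r (π ⟨$⟩ʳ j)) ≡ + toℕ j - + ((n ∸ 1) / 2))

hole : ℕ → ℤ
hole n with n % 2
... | zero = + 1
... | suc _ = + 0

module Submission where

-- Number the sites of L_n from the left as 0, …, n + 1 and let N(t) be the number of chips
-- strictly left of site t; call t tight when N(t) = t.  Along the process N(t) ∈ {t - 1, t},
-- and the number of tight sites never changes.  Hence no site holds three chips, and two chips
-- share site u exactly when N(u) = u - 1 and N(u + 1) = u + 1; toppling them sets both values
-- to u.  So chips stay in L_n, the potential Σ t·N(t) drops by one per move (termination), and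
-- two different moves involve four different chips and commute (local confluence, hence a
-- unique final configuration by Newman's lemma).  Finally, if no site holds two chips then
-- N(t + 1) ≤ N(t) + 1, so the tight sites form an initial segment 0, …, H whose length is the
-- invariant; site H is the only empty one.

open import Defs
open import Data.Nat using (ℕ; suc; _≤_)
open import Data.Integer using (ℤ)
open import Data.Fin using (Fin)
open import Data.Fin.Permutation using (Permutation′)
open import Data.Vec using (lookup)
open import Data.Product using (_×_; ∃-syntax)
open import Relation.Binary.PropositionalEquality using (_≡_; _≢_)
open import Induction.WellFounded using (Acc)

open import Data.Nat as ℕ using (zero; _+_; _*_; _∸_; _⊓_; _<_; z≤n; s≤s; _/_)
import Data.Nat.Properties as ℕ
import Data.Nat.DivMod as ℕ
open import Data.Nat.Induction using (<-wellFounded)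
open import Data.Nat.Tactic.RingSolver using (solve-∀)
open import Data.Integer as ℤ using (+_; -_; _-_; ∣_∣; +<+; +≤+)
import Data.Integer.Properties as ℤ
import Data.Integer.Tactic.RingSolver as ℤ-Solver
open import Data.Fin as Fin using (toℕ; punchIn; punchOut)
import Data.Fin.Properties as Fin
open import Data.Fin.Permutation using (_⟨$⟩ʳ_; _⟨$⟩ˡ_; inverseʳ)
open import Data.Vec using (_[_]≔_)
open import Data.Vec.Properties using (lookup∘update; lookup∘update′; []≔-commutes)
open import Data.Product using (∃; ∃₂; _,_; proj₁; proj₂)
open import Data.Sum using (_⊎_; inj₁; inj₂)
open import Data.Empty using (⊥; ⊥-elim)
open import Function using (_∘_; flip; _⇔_; mk⇔; Equivalence)
open import Induction.WellFounded using (acc; module Subrelation)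
open import Relation.Nullary using (Dec; yes; no; ¬_; contradiction)
open import Relation.Nullary.Decidable using (decidable-stable)
open import Relation.Unary using (Pred; Decidable)
open import Relation.Binary using (Rel; tri<; tri≈; tri>)
open import Relation.Binary.PropositionalEquality
  using (refl; sym; trans; cong; cong₂; subst; subst₂; module ≡-Reasoning)
import Relation.Binary.Construct.On as On
open import Relation.Binary.Construct.Closure.ReflexiveTransitive using (Star; ε; _◅_)
import Relation.Binary.Construct.Closure.ReflexiveTransitive as Star
open import Relation.Binary.Construct.Closure.Transitive using (Plus; [_]; _∼⁺⟨_⟩_)
open import Relation.Binary.Rewriting using (IsNormalForm; Confluent; sn&wcr⇒cr)
open import Algebra.Properties.CommutativeMonoid.Sum ℕ.+-0-commutativeMonoid
  using (sum; sum-remove; sum-permute; sum-cong-≗; ∑-distrib-+)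

𝟙 : ∀ {p} {P : Set p} → Dec P → ℕ
𝟙 (yes _) = 1
𝟙 (no _)  = 0

module _ {p} {P : Set p} where

  𝟙-yes : P → (d : Dec P) → 𝟙 d ≡ 1
  𝟙-yes p (yes _) = refl
  𝟙-yes p (no ¬p) = contradiction p ¬p

  𝟙-no : ¬ P → (d : Dec P) → 𝟙 d ≡ 0
  𝟙-no ¬p (yes p) = contradiction p ¬p
  𝟙-no ¬p (no _)  = refl

  𝟙≤1 : (d : Dec P) → 𝟙 d ≤ 1
  𝟙≤1 (yes _) = s≤s z≤n
  𝟙≤1 (no _)  = z≤n

  0<𝟙⇒ : (d : Dec P) → 0 < 𝟙 d → P
  0<𝟙⇒ (yes p) _ = p

𝟙-cong : ∀ {p q} {P : Set p} {Q : Set q} → P ⇔ Q → (d : Dec P) (e : Dec Q) → 𝟙 d ≡ 𝟙 e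
𝟙-cong P⇔Q d (yes q) = 𝟙-yes (Equivalence.from P⇔Q q) d
𝟙-cong P⇔Q d (no ¬q) = 𝟙-no (¬q ∘ Equivalence.to P⇔Q) d

sum-update : ∀ {m} (f g : Fin m → ℕ) (i : Fin m) → (∀ j → j ≢ i → g j ≡ f j) →
             sum g + f i ≡ sum f + g i
sum-update {m = suc m} f g i g≗f = begin
  sum g + f i                       ≡⟨ cong (_+ f i) (sum-remove g) ⟩
  g i + sum (g ∘ punchIn i) + f i   ≡⟨ cong (λ s → g i + s + f i) rest ⟩
  g i + sum (f ∘ punchIn i) + f i   ≡⟨ shuffle (g i) (sum (f ∘ punchIn i)) (f i) ⟩
  f i + sum (f ∘ punchIn i) + g i   ≡⟨ cong (_+ g i) (sym (sum-remove f)) ⟩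
  sum f + g i                       ∎
  where
  open ≡-Reasoning
  rest : sum (g ∘ punchIn i) ≡ sum (f ∘ punchIn i)
  rest = sum-cong-≗ (λ j → g≗f (punchIn i j) (Fin.punchInᵢ≢i i j))
  shuffle : ∀ a b c → a + b + c ≡ c + b + a
  shuffle = solve-∀

term≤sum : ∀ {m} (f : Fin m → ℕ) (i : Fin m) → f i ≤ sum f
term≤sum {m = suc m} f i = subst (f i ≤_) (sym (sum-remove f)) (ℕ.m≤m+n (f i) _)

private
  punched : ∀ {m} (f : Fin (suc m) → ℕ) {i j : Fin (suc m)} (i≢j : i ≢ j) →
            (f ∘ punchIn i) (punchOut i≢j) ≡ f j
  punched f i≢j = cong f (Fin.punchIn-punchOut i≢j)

pair≤sum : ∀ {m} (f : Fin m → ℕ) {i j : Fin m} → i ≢ j → f i + f j ≤ sum f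
pair≤sum {m = suc m} f {i} i≢j = subst₂ (λ x s → f i + x ≤ s) (punched f i≢j) (sym (sum-remove f))
  (ℕ.+-monoʳ-≤ (f i) (term≤sum (f ∘ punchIn i) (punchOut i≢j)))

triple≤sum : ∀ {m} (f : Fin m → ℕ) {i j k : Fin m} → i ≢ j → i ≢ k → j ≢ k →
             f i + (f j + f k) ≤ sum f
triple≤sum {m = suc m} f {i} i≢j i≢k j≢k =
  subst₂ (λ x s → f i + x ≤ s) (cong₂ _+_ (punched f i≢j) (punched f i≢k)) (sym (sum-remove f))
    (ℕ.+-monoʳ-≤ (f i) (pair≤sum (f ∘ punchIn i) (j≢k ∘ Fin.punchOut-injective i≢j i≢k)))

sum≤card : ∀ {m} (f : Fin m → ℕ) → (∀ i → f i ≤ 1) → sum f ≤ m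
sum≤card {m = zero}  f f≤1 = z≤n
sum≤card {m = suc m} f f≤1 = ℕ.+-mono-≤ (f≤1 Fin.zero) (sum≤card (f ∘ Fin.suc) (f≤1 ∘ Fin.suc))

positive-term : ∀ {m} (f : Fin m → ℕ) → 0 < sum f → ∃[ i ] 0 < f i
positive-term {m = suc m} f 0<sum with f Fin.zero in eq
... | suc _ = Fin.zero , subst (0 <_) (sym eq) (s≤s z≤n)
... | zero  = let i , 0<fi = positive-term (f ∘ Fin.suc) 0<sum in Fin.suc i , 0<fi

two-positive-terms : ∀ {m} (f : Fin m → ℕ) → (∀ i → f i ≤ 1) → 2 ≤ sum f →
                     ∃₂ λ i j → i ≢ j × 0 < f i × 0 < f j
two-positive-terms {m = suc m} f f≤1 2≤sum =
  let i , 0<fi = positive-term f (ℕ.≤-trans (s≤s z≤n) 2≤sum)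
      j , 0<fj = positive-term (f ∘ punchIn i) (ℕ.+-cancelˡ-≤ 1 1 _
                   (ℕ.≤-trans 2≤sum (subst (_≤ 1 + sum (f ∘ punchIn i)) (sym (sum-remove f))
                     (ℕ.+-monoˡ-≤ _ (f≤1 i)))))
  in i , punchIn i j , Fin.punchInᵢ≢i i j ∘ sym , 0<fi , 0<fj

∑< : ℕ → (ℕ → ℕ) → ℕ
∑< zero    f = 0
∑< (suc K) f = f 0 + ∑< K (f ∘ suc)

sum≡∑< : ∀ {k} (f : ℕ → ℕ) → sum {k} (f ∘ toℕ) ≡ ∑< k f
sum≡∑< {zero}  f = refl
sum≡∑< {suc k} f = cong (λ s → f 0 + s) (sum≡∑< {k} (f ∘ suc))

∑<-cong : ∀ K {f g : ℕ → ℕ} → (∀ s → s < K → f s ≡ g s) → ∑< K f ≡ ∑< K g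
∑<-cong zero    f≗g = refl
∑<-cong (suc K) f≗g = cong₂ _+_ (f≗g 0 (s≤s z≤n)) (∑<-cong K (λ s s<K → f≗g (suc s) (s≤s s<K)))

∑<-zero : ∀ K {f : ℕ → ℕ} → (∀ s → s < K → f s ≡ 0) → ∑< K f ≡ 0
∑<-zero zero    f≡0 = refl
∑<-zero (suc K) f≡0 = cong₂ _+_ (f≡0 0 (s≤s z≤n)) (∑<-zero K (λ s s<K → f≡0 (suc s) (s≤s s<K)))

∑<-update₂ : ∀ K u {f g : ℕ → ℕ} d → suc u < K → (∀ s → s ≢ u → s ≢ suc u → g s ≡ f s) →
             g u + g (suc u) + d ≡ f u + f (suc u) → ∑< K g + d ≡ ∑< K f
∑<-update₂ (suc (suc K)) zero {f} {g} d _ g≗f e = begin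
  g 0 + (g 1 + ∑< K (g ∘ suc ∘ suc)) + d ≡⟨ shuffle (g 0) (g 1) (∑< K (g ∘ suc ∘ suc)) d ⟩
  g 0 + g 1 + d + ∑< K (g ∘ suc ∘ suc)   ≡⟨ cong₂ _+_ e (∑<-cong K (λ s _ → g≗f (suc (suc s)) (λ ()) (λ ()))) ⟩
  f 0 + f 1 + ∑< K (f ∘ suc ∘ suc)       ≡⟨ ℕ.+-assoc (f 0) (f 1) _ ⟩
  f 0 + (f 1 + ∑< K (f ∘ suc ∘ suc))     ∎
  where
  open ≡-Reasoning
  shuffle : ∀ a b r d → a + (b + r) + d ≡ a + b + d + r
  shuffle = solve-∀
∑<-update₂ (suc K) (suc u) {f} {g} d (s≤s su<K) g≗f e = begin
  g 0 + ∑< K (g ∘ suc) + d   ≡⟨ ℕ.+-assoc (g 0) _ d ⟩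
  g 0 + (∑< K (g ∘ suc) + d) ≡⟨ cong₂ _+_ (g≗f 0 (λ ()) (λ ())) (∑<-update₂ K u d su<K g≗f′ e) ⟩
  f 0 + ∑< K (f ∘ suc)       ∎
  where
  open ≡-Reasoning
  g≗f′ : ∀ s → s ≢ u → s ≢ suc u → g (suc s) ≡ f (suc s)
  g≗f′ s s≢u s≢su = g≗f (suc s) (s≢u ∘ ℕ.suc-injective) (s≢su ∘ ℕ.suc-injective)

∑<-prefix : ∀ {p} {P : Pred ℕ p} (P? : Decidable P) → (∀ s → P (suc s) → P s) →
            ∀ K t → t < K → P t ⇔ t < ∑< K (𝟙 ∘ P?)
∑<-prefix {P = P} P? down (suc K) t t<K with P? 0
... | no ¬P0 = mk⇔ (λ Pt → contradiction (toZero t Pt) ¬P0) (λ t<0 → contradiction (subst (t <_) none t<0) λ ())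
  where
  toZero : ∀ s → P s → P 0
  toZero zero    Ps = Ps
  toZero (suc s) Ps = toZero s (down s Ps)
  none : ∑< K (𝟙 ∘ P? ∘ suc) ≡ 0
  none = ∑<-zero K (λ s _ → 𝟙-no (¬P0 ∘ toZero (suc s)) (P? (suc s)))
... | yes P0 with t
...   | zero  = mk⇔ (λ _ → s≤s z≤n) (λ _ → P0)
...   | suc t = mk⇔ (s≤s ∘ Equivalence.to IH) (Equivalence.from IH ∘ ℕ.≤-pred)
  where
  IH : P (suc t) ⇔ t < ∑< K (𝟙 ∘ P? ∘ suc)
  IH = ∑<-prefix (P? ∘ suc) (down ∘ suc) K t (ℕ.≤-pred t<K)

∑<-atLeast : ∀ K a → ∑< K (λ t → 𝟙 (a ℕ.≤? t)) ≡ K ∸ a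
∑<-atLeast K       zero    = ∑<-all1 K
  where
  ∑<-all1 : ∀ K → ∑< K (λ t → 𝟙 (0 ℕ.≤? t)) ≡ K
  ∑<-all1 zero    = refl
  ∑<-all1 (suc K) = cong suc (∑<-all1 K)
∑<-atLeast zero    (suc a) = refl
∑<-atLeast (suc K) (suc a) = trans (∑<-cong K (λ t _ → 𝟙-cong (mk⇔ ℕ.≤-pred s≤s) _ _)) (∑<-atLeast K a)

∑<-below : ∀ K t → ∑< K (λ j → 𝟙 (j ℕ.<? t)) ≡ t ⊓ K
∑<-below zero    t       = sym (ℕ.⊓-zeroʳ t)
∑<-below (suc K) zero    = ∑<-zero (suc K) (λ s _ → refl)
∑<-below (suc K) (suc t) = cong suc (trans (∑<-cong K (λ j _ → 𝟙-cong (mk⇔ ℕ.≤-pred s≤s) _ _)) (∑<-below K t))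

module InvariantRewriting {a ℓ p} {A : Set a} (_⟶_ : Rel A ℓ) (Good : Pred A p)
  (good-step : ∀ {x y} → Good x → x ⟶ y → Good y)
  (μ : A → ℕ) (μ-step : ∀ {x y} → Good x → x ⟶ y → μ y < μ x) where

  good-reachable : ∀ {x y} → Good x → Star _⟶_ x y → Good y
  good-reachable gx ε        = gx
  good-reachable gx (s ◅ ss) = good-reachable (good-step gx s) ss

  good-accessible : ∀ {x} → Good x → Acc (flip _⟶_) x
  good-accessible {x} = go (<-wellFounded (μ x))
    where
    go : ∀ {x} → Acc _<_ (μ x) → Good x → Acc (flip _⟶_) x
    go (acc rs) gx = acc λ s → go (rs (μ-step gx s)) (good-step gx s)

  -- Newman's lemma is applied to the restriction of ⟶ to good sources.
  private
    _⟶ᴳ_ : Rel A _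
    x ⟶ᴳ y = Good x × x ⟶ y

    lift : ∀ {x y} → Good x → Star _⟶_ x y → Star _⟶ᴳ_ x y
    lift gx ε        = ε
    lift gx (s ◅ ss) = (gx , s) ◅ lift (good-step gx s) ss

    μ-plus : ∀ {x y} → Plus _⟶ᴳ_ x y → μ y < μ x
    μ-plus [ gx , s ]    = μ-step gx s
    μ-plus (_ ∼⁺⟨ p ⟩ q) = ℕ.<-trans (μ-plus q) (μ-plus p)

    normal-reach : ∀ {y d} → IsNormalForm _⟶_ y → Star _⟶_ y d → y ≡ d
    normal-reach nf ε       = refl
    normal-reach nf (s ◅ _) = contradiction (_ , s) nf

  normal-form-unique :
    (∀ {x y z} → Good x → x ⟶ y → x ⟶ z → ∃ λ d → Star _⟶_ y d × Star _⟶_ z d) →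
    ∀ {x y z} → Good x → Star _⟶_ x y → IsNormalForm _⟶_ y → Star _⟶_ x z → IsNormalForm _⟶_ z → y ≡ z
  normal-form-unique local-confluence gx x↠y nf-y x↠z nf-z =
    let d , y↠d , z↠d = confluent (lift gx x↠y) (lift gx x↠z)
    in trans (normal-reach nf-y (lower y↠d)) (sym (normal-reach nf-z (lower z↠d)))
    where
    lower : ∀ {y d} → Star _⟶ᴳ_ y d → Star _⟶_ y d
    lower = Star.map proj₂
    confluent : Confluent _⟶ᴳ_
    confluent = sn&wcr⇒cr
      (Subrelation.wellFounded μ-plus (On.wellFounded μ <-wellFounded))
      (λ { (gx , s₁) (_ , s₂) → let d , p , q = local-confluence gx s₁ s₂
                                in d , lift (good-step gx s₁) p , lift (good-step gx s₂) q })

<suc⇒≤ : ∀ {x y} → x ℤ.< ℤ.suc y → x ℤ.≤ y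
<suc⇒≤ {x} {y} x<y+1 = subst (x ℤ.≤_) (ℤ.pred-suc y) (ℤ.i<j⇒i≤pred[j] x<y+1)

≤⇒<suc : ∀ {x y} → x ℤ.≤ y → x ℤ.< ℤ.suc y
≤⇒<suc x≤y = ℤ.suc[i]≤j⇒i<j (ℤ.suc-mono x≤y)

𝟙<-suc : ∀ x y → 𝟙 (x ℤ.<? ℤ.suc y) ≡ 𝟙 (x ℤ.<? y) + 𝟙 (x ℤ.≟ y)
𝟙<-suc x y with ℤ.<-cmp x y
... | tri< x<y x≢y _ = trans (𝟙-yes (≤⇒<suc (ℤ.<⇒≤ x<y)) _)
                         (sym (cong₂ _+_ (𝟙-yes x<y (x ℤ.<? y)) (𝟙-no x≢y (x ℤ.≟ y))))
... | tri≈ x≮y refl _ = trans (𝟙-yes (≤⇒<suc ℤ.≤-refl) _)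
                         (sym (cong₂ _+_ (𝟙-no x≮y (x ℤ.<? x)) (𝟙-yes refl (x ℤ.≟ x))))
... | tri> x≮y x≢y y<x = trans (𝟙-no (λ x<y+1 → ℤ.<-irrefl refl (ℤ.<-≤-trans y<x (<suc⇒≤ x<y+1))) _)
                         (sym (cong₂ _+_ (𝟙-no x≮y (x ℤ.<? y)) (𝟙-no x≢y (x ℤ.≟ y))))

module Chips (m : ℕ) (lo : ℤ) where

  site : ℕ → ℤ
  site t = lo ℤ.+ + t

  private
    unshift : ∀ a → - lo ℤ.+ site a ≡ + a
    unshift a = cancel lo (+ a)
      where
      cancel : ∀ l a → - l ℤ.+ (l ℤ.+ a) ≡ a
      cancel = ℤ-Solver.solve-∀

  site-suc : ∀ t → site (suc t) ≡ ℤ.suc (site t)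
  site-suc t = shift lo (+ t)
    where
    shift : ∀ a b → a ℤ.+ (+ 1 ℤ.+ b) ≡ + 1 ℤ.+ (a ℤ.+ b)
    shift = ℤ-Solver.solve-∀

  site-succ : ∀ t → site t ℤ.+ + 1 ≡ site (suc t)
  site-succ t = trans (ℤ.+-comm (site t) (+ 1)) (sym (site-suc t))

  site-pred : ∀ t → site (suc t) - + 1 ≡ site t
  site-pred t = trans (cong (_- + 1) (site-suc t)) (cancel (site t))
    where
    cancel : ∀ a → (+ 1 ℤ.+ a) - + 1 ≡ a
    cancel = ℤ-Solver.solve-∀

  site-mono-≤ : ∀ {a b} → a ≤ b → site a ℤ.≤ site b
  site-mono-≤ a≤b = ℤ.+-monoʳ-≤ lo (+≤+ a≤b)

  site-cancel-≤ : ∀ {a b} → site a ℤ.≤ site b → a ≤ b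
  site-cancel-≤ {a} {b} h with subst₂ ℤ._≤_ (unshift a) (unshift b) (ℤ.+-monoʳ-≤ (- lo) h)
  ... | +≤+ a≤b = a≤b

  site-<⇔ : ∀ {a b} → site a ℤ.< site b ⇔ a < b
  site-<⇔ {a} {b} = mk⇔ cancel (λ a<b → ℤ.+-monoʳ-< lo (+<+ a<b))
    where
    cancel : site a ℤ.< site b → a < b
    cancel h with subst₂ ℤ._<_ (unshift a) (unshift b) (ℤ.+-monoʳ-< (- lo) h)
    ... | +<+ a<b = a<b

  lo≤site : ∀ t → lo ℤ.≤ site t
  lo≤site t = subst (ℤ._≤ site t) (ℤ.+-identityʳ lo) (site-mono-≤ z≤n)

  site-inside : ∀ {x} t → t ≤ m → x ≡ site t → lo ℤ.≤ x × x ℤ.≤ site m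
  site-inside t t≤m refl = lo≤site t , site-mono-≤ t≤m

  site-surjective : ∀ x → lo ℤ.≤ x → x ℤ.≤ site m → ∃[ t ] (t ≤ m × x ≡ site t)
  site-surjective x lo≤x x≤top = ∣ x - lo ∣ , site-cancel-≤ (subst (ℤ._≤ site m) x≡ x≤top) , x≡
    where
    split : ∀ a b → a ≡ b ℤ.+ (a - b)
    split = ℤ-Solver.solve-∀
    x≡ : x ≡ site ∣ x - lo ∣
    x≡ = trans (split x lo) (cong (λ y → lo ℤ.+ y) (sym (ℤ.0≤i⇒+∣i∣≡i (ℤ.i≤j⇒0≤j-i lo≤x))))

  #left : Config m → ℕ → ℕ
  #left c t = sum (λ α → 𝟙 (lookup c α ℤ.<? site t))

  #at : Config m → ℕ → ℕ
  #at c t = sum (λ α → 𝟙 (lookup c α ℤ.≟ site t))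

  #left-suc : ∀ c t → #left c (suc t) ≡ #left c t + #at c t
  #left-suc c t = trans
    (sum-cong-≗ λ α → trans (cong (λ y → 𝟙 (lookup c α ℤ.<? y)) (site-suc t)) (𝟙<-suc (lookup c α) (site t)))
    (∑-distrib-+ (λ α → 𝟙 (lookup c α ℤ.<? site t)) (λ α → 𝟙 (lookup c α ℤ.≟ site t)))

  #left≤m : ∀ c t → #left c t ≤ m
  #left≤m c t = sum≤card _ (λ α → 𝟙≤1 (lookup c α ℤ.<? site t))

  chip≤#at : ∀ c t {α} → lookup c α ≡ site t → 1 ≤ #at c t
  chip≤#at c t {α} at = subst (_≤ #at c t) (𝟙-yes at (lookup c α ℤ.≟ site t)) (term≤sum _ α)

  pair≤#at : ∀ c t {α β} → α ≢ β → lookup c α ≡ site t → lookup c β ≡ site t → 2 ≤ #at c t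
  pair≤#at c t {α} {β} α≢β αat βat = subst (_≤ #at c t)
    (cong₂ _+_ (𝟙-yes αat (lookup c α ℤ.≟ site t)) (𝟙-yes βat (lookup c β ℤ.≟ site t)))
    (pair≤sum _ α≢β)

  #tight : Config m → ℕ
  #tight c = ∑< (suc m) (λ s → 𝟙 (s ℕ.≤? #left c s))

  Ψ : Config m → ℕ
  Ψ c = ∑< (suc (suc m)) (λ t → t * #left c t)

  record Admissible (K : ℕ) (c : Config m) : Set where
    field
      inside     : ∀ α → lo ℤ.≤ lookup c α × lookup c α ℤ.≤ site m
      left-lower : ∀ t → t ≤ suc m → t ≤ suc (#left c t)
      left-upper : ∀ t → #left c t ≤ t
      tight      : #tight c ≡ K

  module _ {K c} (adm : Admissible K c) where
    open Admissible adm

    #at≤2 : ∀ t → t ≤ m → #at c t ≤ 2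
    #at≤2 t t≤m = ℕ.+-cancelˡ-≤ (#left c t) _ _ (begin
      #left c t + #at c t   ≡⟨ #left-suc c t ⟨
      #left c (suc t)       ≤⟨ left-upper (suc t) ⟩
      suc t                 ≤⟨ s≤s (left-lower t (ℕ.m≤n⇒m≤1+n t≤m)) ⟩
      suc (suc (#left c t)) ≡⟨ ℕ.+-comm 2 (#left c t) ⟩
      #left c t + 2         ∎)
      where open ℕ.≤-Reasoning

    chip-site : ∀ α → ∃[ t ] (t ≤ m × lookup c α ≡ site t)
    chip-site α = site-surjective _ (proj₁ (inside α)) (proj₂ (inside α))

    no-triple : ∀ {α β γ} → α ≢ β → α ≢ γ → β ≢ γ →
                lookup c β ≡ lookup c α → lookup c γ ≡ lookup c α → ⊥
    no-triple {α} {β} {γ} α≢β α≢γ β≢γ βα γα =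
      let t , t≤m , at = chip-site α
          hits : ∀ {δ} → lookup c δ ≡ lookup c α → 𝟙 (lookup c δ ℤ.≟ site t) ≡ 1
          hits {δ} δα = 𝟙-yes (trans δα at) (lookup c δ ℤ.≟ site t)
          3≤#at = subst (_≤ #at c t) (cong₂ _+_ (hits refl) (cong₂ _+_ (hits βα) (hits γα)))
                    (triple≤sum _ α≢β α≢γ β≢γ)
      in contradiction (ℕ.≤-trans 3≤#at (#at≤2 t t≤m)) λ { (s≤s (s≤s ())) }

    crowded : ∀ {α β} → α ≢ β → lookup c α ≡ lookup c β →
              ∃[ v ] (lookup c α ≡ site (suc v) × #left c (suc v) ≡ v × #left c (suc (suc v)) ≡ suc (suc v))
    crowded {α} {β} α≢β same with chip-site α
    ... | u , u≤m , at = #left c u , subst (λ x → lookup c α ≡ site x) u≡ at , cong (#left c) (sym u≡)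
                        , ℕ.≤-antisym (subst (λ x → #left c (suc x) ≤ suc x) u≡ (left-upper (suc u)))
                                      (subst (λ x → suc (suc (#left c u)) ≤ #left c (suc x)) u≡ 2+v≤)
      where
      2+v≤ : suc (suc (#left c u)) ≤ #left c (suc u)
      2+v≤ = subst₂ _≤_ (ℕ.+-comm (#left c u) 2) (sym (#left-suc c u))
               (ℕ.+-monoʳ-≤ (#left c u) (pair≤#at c u α≢β at (trans (sym same) at)))
      u≡ : u ≡ suc (#left c u)
      u≡ = ℕ.≤-antisym (left-lower u (ℕ.m≤n⇒m≤1+n u≤m)) (ℕ.≤-pred (ℕ.≤-trans 2+v≤ (left-upper (suc u))))

  topple : Config m → Fin m → Fin m → Config m
  topple c α β = (c [ α ]≔ (lookup c α - + 1)) [ β ]≔ (lookup c β ℤ.+ + 1)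

  module _ (c : Config m) {α β : Fin m} (α≢β : α ≢ β) where
    private
      c₁ : Config m
      c₁ = c [ α ]≔ (lookup c α - + 1)

    topple-α : lookup (topple c α β) α ≡ lookup c α - + 1
    topple-α = trans (lookup∘update′ α≢β c₁ _) (lookup∘update α c _)

    topple-β : lookup (topple c α β) β ≡ lookup c β ℤ.+ + 1
    topple-β = lookup∘update β c₁ _

    topple-other : ∀ {γ} → γ ≢ α → γ ≢ β → lookup (topple c α β) γ ≡ lookup c γ
    topple-other γ≢α γ≢β = trans (lookup∘update′ γ≢β c₁ _) (lookup∘update′ γ≢α c _)

  #left-move : ∀ c α x t → #left (c [ α ]≔ x) t + 𝟙 (lookup c α ℤ.<? site t) ≡ #left c t + 𝟙 (x ℤ.<? site t)
  #left-move c α x t = trans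
    (sum-update _ _ α (λ γ γ≢α → cong (λ y → 𝟙 (y ℤ.<? site t)) (lookup∘update′ γ≢α c x)))
    (cong (λ y → #left c t + 𝟙 (y ℤ.<? site t)) (lookup∘update α c x))

  #left-topple : ∀ c {α β} → α ≢ β → ∀ t →
    #left (topple c α β) t + 𝟙 (lookup c α ℤ.<? site t) + 𝟙 (lookup c β ℤ.<? site t)
      ≡ #left c t + 𝟙 (lookup c α - + 1 ℤ.<? site t) + 𝟙 (lookup c β ℤ.+ + 1 ℤ.<? site t)
  #left-topple c {α} {β} α≢β t = begin
    #left (topple c α β) t + a + b  ≡⟨ swap _ a b ⟩
    #left (topple c α β) t + b + a  ≡⟨ cong (_+ a) second ⟩
    #left c₁ t + b′ + a             ≡⟨ swap _ b′ a ⟩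
    #left c₁ t + a + b′             ≡⟨ cong (_+ b′) (#left-move c α _ t) ⟩
    #left c t + a′ + b′             ∎
    where
    open ≡-Reasoning
    c₁ : Config m
    c₁ = c [ α ]≔ (lookup c α - + 1)
    a b a′ b′ : ℕ
    a  = 𝟙 (lookup c α ℤ.<? site t)
    b  = 𝟙 (lookup c β ℤ.<? site t)
    a′ = 𝟙 (lookup c α - + 1 ℤ.<? site t)
    b′ = 𝟙 (lookup c β ℤ.+ + 1 ℤ.<? site t)
    swap : ∀ x y z → x + y + z ≡ x + z + y
    swap = solve-∀
    second : #left (topple c α β) t + b ≡ #left c₁ t + b′
    second = trans (cong (λ y → #left (topple c α β) t + 𝟙 (y ℤ.<? site t)) (sym (lookup∘update′ (α≢β ∘ sym) c _)))
                   (#left-move c₁ β _ t)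

  𝟙-site< : ∀ {x} a t → x ≡ site a → 𝟙 (x ℤ.<? site t) ≡ 𝟙 (a ℕ.<? t)
  𝟙-site< a t refl = 𝟙-cong site-<⇔ _ _

  module Toppling {K c} (adm : Admissible K c) {α β} (α≢β : α ≢ β) (same : lookup c α ≡ lookup c β) where
    open Admissible adm

    private
      v u : ℕ
      v = proj₁ (crowded adm α≢β same)
      u = suc v

      c′ : Config m
      c′ = topple c α β

      at-u : lookup c α ≡ site u
      at-u = proj₁ (proj₂ (crowded adm α≢β same))

      #left-u : #left c u ≡ v
      #left-u = proj₁ (proj₂ (proj₂ (crowded adm α≢β same)))

      #left-su : #left c (suc u) ≡ suc u
      #left-su = proj₂ (proj₂ (proj₂ (crowded adm α≢β same)))

      su≤m : suc u ≤ m
      su≤m = subst (_≤ m) #left-su (#left≤m c (suc u))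

      #left-after : ∀ t → #left c′ t + (𝟙 (u ℕ.<? t) + 𝟙 (u ℕ.<? t))
                        ≡ #left c t + (𝟙 (v ℕ.<? t) + 𝟙 (suc u ℕ.<? t))
      #left-after t = begin
        #left c′ t + (𝟙 (u ℕ.<? t) + 𝟙 (u ℕ.<? t))
          ≡⟨ cong₂ (λ x y → #left c′ t + (x + y)) (𝟙-site< u t at-u) (𝟙-site< u t (trans (sym same) at-u)) ⟨
        #left c′ t + (𝟙 (lookup c α ℤ.<? site t) + 𝟙 (lookup c β ℤ.<? site t))
          ≡⟨ sym (ℕ.+-assoc (#left c′ t) _ _) ⟩
        #left c′ t + 𝟙 (lookup c α ℤ.<? site t) + 𝟙 (lookup c β ℤ.<? site t)
          ≡⟨ #left-topple c α≢β t ⟩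
        #left c t + 𝟙 (lookup c α - + 1 ℤ.<? site t) + 𝟙 (lookup c β ℤ.+ + 1 ℤ.<? site t)
          ≡⟨ ℕ.+-assoc (#left c t) _ _ ⟩
        #left c t + (𝟙 (lookup c α - + 1 ℤ.<? site t) + 𝟙 (lookup c β ℤ.+ + 1 ℤ.<? site t))
          ≡⟨ cong₂ (λ x y → #left c t + (x + y))
               (𝟙-site< v t (trans (cong (_- + 1) at-u) (site-pred v)))
               (𝟙-site< (suc u) t (trans (cong (ℤ._+ + 1) (trans (sym same) at-u)) (site-succ u))) ⟩
        #left c t + (𝟙 (v ℕ.<? t) + 𝟙 (suc u ℕ.<? t)) ∎
        where open ≡-Reasoning

      #left-after-u : #left c′ u ≡ u
      #left-after-u = begin
        #left c′ u                                    ≡⟨ ℕ.+-identityʳ _ ⟨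
        #left c′ u + 0                                ≡⟨ cong (λ x → #left c′ u + (x + x)) (𝟙-no (ℕ.<-irrefl refl) (u ℕ.<? u)) ⟨
        #left c′ u + (𝟙 (u ℕ.<? u) + 𝟙 (u ℕ.<? u))    ≡⟨ #left-after u ⟩
        #left c u + (𝟙 (v ℕ.<? u) + 𝟙 (suc u ℕ.<? u)) ≡⟨ cong₂ (λ x y → x + (y + 𝟙 (suc u ℕ.<? u))) #left-u (𝟙-yes (ℕ.n<1+n v) _) ⟩
        v + (1 + 𝟙 (suc u ℕ.<? u))                    ≡⟨ cong (λ x → v + (1 + x)) (𝟙-no (ℕ.<-asym (ℕ.n<1+n u)) _) ⟩
        v + 1                                          ≡⟨ ℕ.+-comm v 1 ⟩
        u                                              ∎
        where open ≡-Reasoning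

      #left-after-su : #left c′ (suc u) ≡ u
      #left-after-su = ℕ.+-cancelʳ-≡ 2 _ _ (begin
        #left c′ (suc u) + 2                                    ≡⟨ cong (λ x → #left c′ (suc u) + x) both ⟨
        #left c′ (suc u) + (𝟙 (u ℕ.<? suc u) + 𝟙 (u ℕ.<? suc u)) ≡⟨ #left-after (suc u) ⟩
        #left c (suc u) + (𝟙 (v ℕ.<? suc u) + 𝟙 (suc u ℕ.<? suc u))
          ≡⟨ cong₂ (λ x y → x + (y + 𝟙 (suc u ℕ.<? suc u))) #left-su (𝟙-yes (ℕ.<-trans (ℕ.n<1+n v) (ℕ.n<1+n u)) _) ⟩
        suc u + (1 + 𝟙 (suc u ℕ.<? suc u))                      ≡⟨ cong (λ x → suc u + (1 + x)) (𝟙-no (ℕ.<-irrefl refl) _) ⟩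
        suc u + 1                                               ≡⟨ ℕ.+-suc u 1 ⟨
        u + 2                                                   ∎)
        where
        open ≡-Reasoning
        both : 𝟙 (u ℕ.<? suc u) + 𝟙 (u ℕ.<? suc u) ≡ 2
        both = cong₂ _+_ (𝟙-yes (ℕ.n<1+n u) (u ℕ.<? suc u)) (𝟙-yes (ℕ.n<1+n u) (u ℕ.<? suc u))

      #left-after-other : ∀ t → t ≢ u → t ≢ suc u → #left c′ t ≡ #left c t
      #left-after-other t t≢u t≢su = ℕ.+-cancelʳ-≡ _ _ _
        (trans (#left-after t) (cong (λ x → #left c t + x) (sym unchanged)))
        where
        unchanged : 𝟙 (u ℕ.<? t) + 𝟙 (u ℕ.<? t) ≡ 𝟙 (v ℕ.<? t) + 𝟙 (suc u ℕ.<? t)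
        unchanged with ℕ.<-cmp t u
        ... | tri< t<u _ _ = trans
          (cong₂ _+_ (𝟙-no (ℕ.<-asym t<u) (u ℕ.<? t)) (𝟙-no (ℕ.<-asym t<u) (u ℕ.<? t)))
          (sym (cong₂ _+_ (𝟙-no (λ v<t → ℕ.<-irrefl refl (ℕ.<-≤-trans v<t (ℕ.≤-pred t<u))) (v ℕ.<? t))
                          (𝟙-no (ℕ.<-asym (ℕ.<-trans t<u (ℕ.n<1+n u))) (suc u ℕ.<? t))))
        ... | tri≈ _ t≡u _ = contradiction t≡u t≢u
        ... | tri> _ _ u<t = trans
          (cong₂ _+_ (𝟙-yes u<t (u ℕ.<? t)) (𝟙-yes u<t (u ℕ.<? t)))
          (sym (cong₂ _+_ (𝟙-yes (ℕ.<-trans (ℕ.n<1+n v) u<t) (v ℕ.<? t))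
                          (𝟙-yes (ℕ.≤∧≢⇒< u<t (t≢su ∘ sym)) (suc u ℕ.<? t))))

      sites : ∀ t → t ≡ u ⊎ t ≡ suc u ⊎ (t ≢ u × t ≢ suc u)
      sites t with t ℕ.≟ u | t ℕ.≟ suc u
      ... | yes t≡u | _        = inj₁ t≡u
      ... | no _    | yes t≡su = inj₂ (inj₁ t≡su)
      ... | no t≢u  | no t≢su  = inj₂ (inj₂ (t≢u , t≢su))

    admissible : Admissible K c′
    admissible = record { inside = inside′ ; left-lower = lower′ ; left-upper = upper′ ; tight = tight′ }
      where
      inside′ : ∀ γ → lo ℤ.≤ lookup c′ γ × lookup c′ γ ℤ.≤ site m
      inside′ γ with γ Fin.≟ α | γ Fin.≟ β
      ... | yes refl | _ = site-inside v (ℕ.≤-trans (ℕ.n≤1+n v) (ℕ.≤-trans (ℕ.n≤1+n u) su≤m))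
                             (trans (topple-α c α≢β) (trans (cong (_- + 1) at-u) (site-pred v)))
      ... | no _ | yes refl = site-inside (suc u) su≤m
                                (trans (topple-β c α≢β) (trans (cong (ℤ._+ + 1) (trans (sym same) at-u)) (site-succ u)))
      ... | no γ≢α | no γ≢β = subst (λ x → lo ℤ.≤ x × x ℤ.≤ site m) (sym (topple-other c α≢β γ≢α γ≢β)) (inside γ)

      lower′ : ∀ t → t ≤ suc m → t ≤ suc (#left c′ t)
      lower′ t t≤ with sites t
      ... | inj₁ refl               = subst (λ x → u ≤ suc x) (sym #left-after-u) (ℕ.n≤1+n u)
      ... | inj₂ (inj₁ refl)        = s≤s (ℕ.≤-reflexive (sym #left-after-su))
      ... | inj₂ (inj₂ (t≢u , t≢su)) = subst (λ x → t ≤ suc x) (sym (#left-after-other t t≢u t≢su)) (left-lower t t≤)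

      upper′ : ∀ t → #left c′ t ≤ t
      upper′ t with sites t
      ... | inj₁ refl               = ℕ.≤-reflexive #left-after-u
      ... | inj₂ (inj₁ refl)        = subst (_≤ suc u) (sym #left-after-su) (ℕ.n≤1+n u)
      ... | inj₂ (inj₂ (t≢u , t≢su)) = subst (_≤ t) (sym (#left-after-other t t≢u t≢su)) (left-upper t)

      -- Site u becomes tight and site u + 1 stops being tight.
      tight′ : #tight c′ ≡ K
      tight′ = trans (sym (ℕ.+-identityʳ _))
        (trans (∑<-update₂ (suc m) u 0 (s≤s su≤m)
                  (λ s s≢u s≢su → cong (λ x → 𝟙 (s ℕ.≤? x)) (#left-after-other s s≢u s≢su)) swap)
               tight)
        where
        swap : 𝟙 (u ℕ.≤? #left c′ u) + 𝟙 (suc u ℕ.≤? #left c′ (suc u)) + 0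
             ≡ 𝟙 (u ℕ.≤? #left c u) + 𝟙 (suc u ℕ.≤? #left c (suc u))
        swap = trans
          (cong₂ (λ x y → x + y + 0)
            (𝟙-yes (ℕ.≤-reflexive (sym #left-after-u)) (u ℕ.≤? #left c′ u))
            (𝟙-no (λ h → ℕ.<-irrefl refl (subst (suc u ≤_) #left-after-su h)) (suc u ℕ.≤? #left c′ (suc u))))
          (sym (cong₂ _+_
            (𝟙-no (λ h → ℕ.<-irrefl refl (subst (u ≤_) #left-u h)) (u ℕ.≤? #left c u))
            (𝟙-yes (ℕ.≤-reflexive (sym #left-su)) (suc u ℕ.≤? #left c (suc u)))))

    Ψ-decreases : Ψ c′ + 1 ≡ Ψ c
    Ψ-decreases = ∑<-update₂ (suc (suc m)) u 1 (s≤s (ℕ.m≤n⇒m≤1+n su≤m))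
      (λ s s≢u s≢su → cong (s *_) (#left-after-other s s≢u s≢su))
      (trans (cong₂ (λ x y → u * x + suc u * y + 1) #left-after-u #left-after-su)
      (trans (identity v)
             (sym (cong₂ (λ x y → u * x + suc u * y) #left-u #left-su))))
      where
      identity : ∀ v → suc v * suc v + suc (suc v) * suc v + 1 ≡ suc v * v + suc (suc v) * suc (suc v)
      identity = solve-∀

  topple-commute : ∀ c {α β γ δ} → α ≢ β → γ ≢ δ → α ≢ γ → α ≢ δ → β ≢ γ → β ≢ δ →
                   topple (topple c α β) γ δ ≡ topple (topple c γ δ) α β
  topple-commute c {α} {β} {γ} {δ} α≢β γ≢δ α≢γ α≢δ β≢γ β≢δ = begin
    topple (topple c α β) γ δ
      ≡⟨ cong₂ (λ x y → (topple c α β [ γ ]≔ (x - + 1)) [ δ ]≔ (y ℤ.+ + 1))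
           (topple-other c α≢β (α≢γ ∘ sym) (β≢γ ∘ sym)) (topple-other c α≢β (α≢δ ∘ sym) (β≢δ ∘ sym)) ⟩
    (((c [ α ]≔ a) [ β ]≔ b) [ γ ]≔ g) [ δ ]≔ d ≡⟨ cong (_[ δ ]≔ d) ([]≔-commutes (c [ α ]≔ a) β γ β≢γ) ⟩
    (((c [ α ]≔ a) [ γ ]≔ g) [ β ]≔ b) [ δ ]≔ d ≡⟨ cong (λ x → (x [ β ]≔ b) [ δ ]≔ d) ([]≔-commutes c α γ α≢γ) ⟩
    (((c [ γ ]≔ g) [ α ]≔ a) [ β ]≔ b) [ δ ]≔ d ≡⟨ []≔-commutes _ β δ β≢δ ⟩
    (((c [ γ ]≔ g) [ α ]≔ a) [ δ ]≔ d) [ β ]≔ b ≡⟨ cong (_[ β ]≔ b) ([]≔-commutes (c [ γ ]≔ g) α δ α≢δ) ⟩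
    (((c [ γ ]≔ g) [ δ ]≔ d) [ α ]≔ a) [ β ]≔ b
      ≡⟨ cong₂ (λ x y → (topple c γ δ [ α ]≔ (x - + 1)) [ β ]≔ (y ℤ.+ + 1))
           (topple-other c γ≢δ α≢γ α≢δ) (topple-other c γ≢δ β≢γ β≢δ) ⟨
    topple (topple c γ δ) α β ∎
    where
    open ≡-Reasoning
    a b g d : ℤ
    a = lookup c α - + 1
    b = lookup c β ℤ.+ + 1
    g = lookup c γ - + 1
    d = lookup c δ ℤ.+ + 1

  step-admissible : ∀ {K c c′} → Admissible K c → Step c c′ → Admissible K c′
  step-admissible adm (α , β , α<β , same , refl) = Toppling.admissible adm (Fin.<⇒≢ α<β) same

  Ψ-step : ∀ {K c c′} → Admissible K c → Step c c′ → Ψ c′ < Ψ c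
  Ψ-step {c = c} adm (α , β , α<β , same , refl) =
    subst (Ψ (topple c α β) <_) (Toppling.Ψ-decreases adm (Fin.<⇒≢ α<β) same) (ℕ.m<m+n _ (s≤s z≤n))

  -- Different topplings on one site would need three chips there.
  local-confluence : ∀ {K c a b} → Admissible K c → Step c a → Step c b →
                     ∃ λ d → Reachable a d × Reachable b d
  local-confluence {c = c} adm (α , β , α<β , αβ , refl) (γ , δ , γ<δ , γδ , refl)
    with lookup c α ℤ.≟ lookup c γ
  ... | no αγ = topple (topple c α β) γ δ
              , (γ , δ , γ<δ , moved γ≢α γ≢β δ≢α δ≢β γδ , refl) ◅ ε
              , (α , β , α<β , moved′
                , topple-commute c α≢β γ≢δ (γ≢α ∘ sym) (δ≢α ∘ sym) (γ≢β ∘ sym) (δ≢β ∘ sym)) ◅ ε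
    where
    α≢β : α ≢ β
    α≢β = Fin.<⇒≢ α<β
    γ≢δ : γ ≢ δ
    γ≢δ = Fin.<⇒≢ γ<δ
    γ≢α : γ ≢ α
    γ≢α γ≡α = αγ (cong (lookup c) (sym γ≡α))
    γ≢β : γ ≢ β
    γ≢β γ≡β = αγ (trans αβ (cong (lookup c) (sym γ≡β)))
    δ≢α : δ ≢ α
    δ≢α δ≡α = αγ (trans (cong (lookup c) (sym δ≡α)) (sym γδ))
    δ≢β : δ ≢ β
    δ≢β δ≡β = αγ (trans αβ (trans (cong (lookup c) (sym δ≡β)) (sym γδ)))
    moved : ∀ {x y} → x ≢ α → x ≢ β → y ≢ α → y ≢ β → lookup c x ≡ lookup c y →
            lookup (topple c α β) x ≡ lookup (topple c α β) y
    moved x≢α x≢β y≢α y≢β xy = trans (topple-other c α≢β x≢α x≢β) (trans xy (sym (topple-other c α≢β y≢α y≢β)))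
    moved′ : lookup (topple c γ δ) α ≡ lookup (topple c γ δ) β
    moved′ = trans (topple-other c γ≢δ (γ≢α ∘ sym) (δ≢α ∘ sym))
               (trans αβ (sym (topple-other c γ≢δ (γ≢β ∘ sym) (δ≢β ∘ sym))))
  ... | yes αγ with α Fin.≟ γ | β Fin.≟ δ
  ...   | yes refl | yes refl = _ , ε , ε
  ...   | yes refl | no β≢δ = ⊥-elim (no-triple adm (Fin.<⇒≢ α<β) (Fin.<⇒≢ γ<δ) β≢δ (sym αβ) (sym γδ))
  ...   | no α≢γ | _ with β Fin.≟ γ
  ...     | yes refl = ⊥-elim (no-triple adm (Fin.<⇒≢ α<β) (Fin.<⇒≢ (Fin.<-trans α<β γ<δ)) (Fin.<⇒≢ γ<δ)
                                 (sym αβ) (trans (sym γδ) (sym αβ)))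
  ...     | no β≢γ = ⊥-elim (no-triple adm (Fin.<⇒≢ α<β) α≢γ β≢γ (sym αβ) (sym αγ))

  stable⇒normal : ∀ {c : Config m} → Stable c → IsNormalForm Step c
  stable⇒normal stable (_ , α , β , α<β , same , _) = stable α β (Fin.<⇒≢ α<β) same

  module StableConfiguration {H c} (adm : Admissible (suc H) c) (stable : Stable c) (H≤m : H ≤ m) where
    open Admissible adm

    #at≤1 : ∀ t → #at c t ≤ 1
    #at≤1 t with #at c t ℕ.≤? 1
    ... | yes ≤1 = ≤1
    ... | no ≰1 =
      let α , β , α≢β , 0<α , 0<β = two-positive-terms _ (λ α → 𝟙≤1 (lookup c α ℤ.≟ site t)) (ℕ.≰⇒> ≰1)
      in contradiction (trans (0<𝟙⇒ _ 0<α) (sym (0<𝟙⇒ _ 0<β))) (stable α β α≢β)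

    tight-down : ∀ s → suc s ≤ #left c (suc s) → s ≤ #left c s
    tight-down s tight-s+1 = ℕ.≤-pred (begin
      suc s                    ≤⟨ tight-s+1 ⟩
      #left c (suc s)          ≡⟨ #left-suc c s ⟩
      #left c s + #at c s      ≤⟨ ℕ.+-monoʳ-≤ (#left c s) (#at≤1 s) ⟩
      #left c s + 1            ≡⟨ ℕ.+-comm (#left c s) 1 ⟩
      suc (#left c s)          ∎)
      where open ℕ.≤-Reasoning

    tight⇔≤H : ∀ t → t ≤ m → t ≤ #left c t ⇔ t ≤ H
    tight⇔≤H t t≤m = mk⇔ (ℕ.≤-pred ∘ subst (t <_) tight ∘ Equivalence.to prefix)
                         (Equivalence.from prefix ∘ subst (t <_) (sym tight) ∘ s≤s)
      where prefix = ∑<-prefix (λ s → s ℕ.≤? #left c s) tight-down (suc m) t (s≤s t≤m)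

    #left-stable : ∀ t → t ≤ suc m → #left c t + 𝟙 (H ℕ.<? t) ≡ t
    #left-stable t t≤ with H ℕ.<? t
    ... | no H≮t = trans (ℕ.+-identityʳ _)
      (ℕ.≤-antisym (left-upper t) (Equivalence.from (tight⇔≤H t (ℕ.≤-trans t≤H H≤m)) t≤H))
      where t≤H = ℕ.≮⇒≥ H≮t
    ... | yes H<t = trans (ℕ.+-comm _ 1) (ℕ.≤-antisym (ℕ.≰⇒> loose) (left-lower t t≤))
      where
      loose : ¬ t ≤ #left c t
      loose t≤#left with t ℕ.≤? m
      ... | yes t≤m = ℕ.<⇒≱ H<t (Equivalence.to (tight⇔≤H t t≤m) t≤#left)
      ... | no t≰m  = t≰m (ℕ.≤-trans t≤#left (#left≤m c t))

    #at-stable : ∀ t → t ≤ m → #at c t + 𝟙 (H ℕ.<? suc t) ≡ suc (𝟙 (H ℕ.<? t))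
    #at-stable t t≤m = ℕ.+-cancelˡ-≡ (#left c t) _ _ (begin
      #left c t + (#at c t + 𝟙 (H ℕ.<? suc t)) ≡⟨ ℕ.+-assoc (#left c t) _ _ ⟨
      #left c t + #at c t + 𝟙 (H ℕ.<? suc t)   ≡⟨ cong (_+ 𝟙 (H ℕ.<? suc t)) (#left-suc c t) ⟨
      #left c (suc t) + 𝟙 (H ℕ.<? suc t)       ≡⟨ #left-stable (suc t) (s≤s t≤m) ⟩
      suc t                                     ≡⟨ cong suc (#left-stable t (ℕ.m≤n⇒m≤1+n t≤m)) ⟨
      suc (#left c t + 𝟙 (H ℕ.<? t))           ≡⟨ ℕ.+-suc (#left c t) _ ⟨
      #left c t + suc (𝟙 (H ℕ.<? t))           ∎)
      where open ≡-Reasoning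

    hole-empty : ∀ α → lookup c α ≢ site H
    hole-empty α at = contradiction (chip≤#at c H at) (λ 1≤#at → ℕ.<-irrefl refl (subst (0 <_) #at≡0 1≤#at))
      where
      #at≡0 : #at c H ≡ 0
      #at≡0 = ℕ.+-cancelʳ-≡ 1 _ _ (trans
        (cong (λ x → #at c H + x) (sym (𝟙-yes (ℕ.n<1+n H) (H ℕ.<? suc H))))
        (trans (#at-stable H H≤m) (cong suc (𝟙-no (ℕ.<-irrefl refl) (H ℕ.<? H)))))

    unique-chip : ∀ t → t ≤ m → t ≢ H → ∃[ α ] (lookup c α ≡ site t × ∀ β → lookup c β ≡ site t → β ≡ α)
    unique-chip t t≤m t≢H =
      let α , 0<𝟙 = positive-term _ (subst (0 <_) (sym #at≡1) (s≤s z≤n))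
          at = 0<𝟙⇒ (lookup c α ℤ.≟ site t) 0<𝟙
      in α , at , λ β βat → decidable-stable (β Fin.≟ α)
                              (λ β≢α → stable β α β≢α (trans βat (sym at)))
      where
      #at≡1 : #at c t ≡ 1
      #at≡1 = ℕ.+-cancelʳ-≡ _ _ _ (trans (#at-stable t t≤m)
        (cong suc (𝟙-cong (mk⇔ ℕ.m<n⇒m<1+n (λ H<t+1 → ℕ.≤∧≢⇒< (ℕ.≤-pred H<t+1) (t≢H ∘ sym))) _ _)))

half-suc-suc : ∀ n → suc (suc n) / 2 ≡ suc (n / 2)
half-suc-suc n = ℕ.m/n≡1+[m∸n]/n {suc (suc n)} (s≤s (s≤s z≤n))

halves : ∀ n → suc n / 2 + n / 2 ≡ n
halves zero          = refl
halves (suc zero)    = refl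
halves (suc (suc n)) = begin
  suc (suc (suc n)) / 2 + suc (suc n) / 2 ≡⟨ cong₂ _+_ (half-suc-suc (suc n)) (half-suc-suc n) ⟩
  suc (suc n / 2) + suc (n / 2)         ≡⟨ cong suc (ℕ.+-suc (suc n / 2) (n / 2)) ⟩
  suc (suc (suc n / 2 + n / 2))         ≡⟨ cong (suc ∘ suc) (halves n) ⟩
  suc (suc n)                           ∎
  where open ≡-Reasoning

hole-suc-suc : ∀ n → hole (suc (suc n)) ≡ hole n
hole-suc-suc n with n ℕ.% 2
... | zero  = refl
... | suc _ = refl

ceil-half-pred : ∀ n → 1 ≤ n → suc n / 2 ≡ suc ((n ∸ 1) / 2)
ceil-half-pred (suc n) _ = half-suc-suc n

ceil-half+hole : ∀ n → + (suc n / 2) ℤ.+ hole n ≡ + suc (n / 2)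
ceil-half+hole zero          = refl
ceil-half+hole (suc zero)    = refl
ceil-half+hole (suc (suc n)) = begin
  + (suc (suc (suc n)) / 2) ℤ.+ hole (suc (suc n)) ≡⟨ cong₂ (λ a h → + a ℤ.+ h) (half-suc-suc (suc n)) (hole-suc-suc n) ⟩
  + suc (suc n / 2) ℤ.+ hole n                      ≡⟨ ℤ.+-assoc (+ 1) (+ (suc n / 2)) (hole n) ⟩
  + 1 ℤ.+ (+ (suc n / 2) ℤ.+ hole n)                ≡⟨ cong (λ x → + 1 ℤ.+ x) (ceil-half+hole n) ⟩
  + suc (suc (n / 2))                               ≡⟨ cong (λ a → + suc a) (half-suc-suc n) ⟨
  + suc (suc (suc n) / 2)                           ∎
  where open ≡-Reasoning

-- The origin is site A = ⌈n/2⌉, the hole is site H and the initial configuration occupies sites 1, …, n.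
module Initial (n : ℕ) (1≤n : 1 ≤ n) (π : Permutation′ n) (r : Fin (suc n)) (c₀ : Config (suc n))
               (initial : IsInitial n π r c₀) where

  A H : ℕ
  A = suc n / 2
  H = suc (n / 2)

  open Chips (suc n) (- + A)

  A+H≡1+n : A + H ≡ suc n
  A+H≡1+n = trans (ℕ.+-suc A (n / 2)) (cong suc (halves n))

  A≤n : A ≤ n
  A≤n = subst (A ≤_) (halves n) (ℕ.m≤m+n A (n / 2))

  H≤1+n : H ≤ suc n
  H≤1+n = s≤s (ℕ.m/n≤m n 2)

  top-site : site (suc n) ≡ + (n / 2 + 1)
  top-site = trans (cong (λ k → - + A ℤ.+ + k) (sym A+H≡1+n))
                   (trans (cancel (+ A) (+ H)) (cong +_ (ℕ.+-comm 1 (n / 2))))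
    where
    cancel : ∀ a h → - a ℤ.+ (a ℤ.+ h) ≡ h
    cancel = ℤ-Solver.solve-∀

  hole-site : hole n ≡ site H
  hole-site = trans (cancel (+ A) (hole n)) (cong (λ x → - + A ℤ.+ x) (ceil-half+hole n))
    where
    cancel : ∀ a h → h ≡ - a ℤ.+ (a ℤ.+ h)
    cancel = ℤ-Solver.solve-∀

  chip-r : lookup c₀ r ≡ site A
  chip-r = trans (proj₁ initial) (sym (ℤ.+-inverseˡ (+ A)))

  chip-entry : ∀ j → lookup c₀ (punchIn r (π ⟨$⟩ʳ j)) ≡ site (suc (toℕ j))
  chip-entry j = trans (proj₂ initial j)
    (trans (shift (+ toℕ j) (+ ((n ∸ 1) / 2))) (cong (λ a → - + a ℤ.+ + suc (toℕ j)) (sym (ceil-half-pred n 1≤n))))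
    where
    shift : ∀ j b → j - b ≡ - (+ 1 ℤ.+ b) ℤ.+ (+ 1 ℤ.+ j)
    shift = ℤ-Solver.solve-∀

  chips : ∀ α → α ≡ r ⊎ ∃[ j ] α ≡ punchIn r (π ⟨$⟩ʳ j)
  chips α with α Fin.≟ r
  ... | yes α≡r = inj₁ α≡r
  ... | no α≢r  = inj₂ (π ⟨$⟩ˡ punchOut (α≢r ∘ sym)
                       , trans (sym (Fin.punchIn-punchOut (α≢r ∘ sym))) (cong (punchIn r) (sym (inverseʳ π))))

  #left-initial : ∀ t → #left c₀ t ≡ 𝟙 (A ℕ.<? t) + (t ∸ 1) ⊓ n
  #left-initial t = begin
    #left c₀ t                                          ≡⟨ sum-remove f ⟩
    f r + sum (f ∘ punchIn r)                           ≡⟨ cong₂ _+_ (𝟙-site< A t chip-r) (sum-permute (f ∘ punchIn r) π) ⟩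
    𝟙 (A ℕ.<? t) + sum (f ∘ punchIn r ∘ (π ⟨$⟩ʳ_))     ≡⟨ cong (λ s → 𝟙 (A ℕ.<? t) + s) entries ⟩
    𝟙 (A ℕ.<? t) + (t ∸ 1) ⊓ n                          ∎
    where
    open ≡-Reasoning
    f : Fin (suc n) → ℕ
    f α = 𝟙 (lookup c₀ α ℤ.<? site t)
    entries : sum (f ∘ punchIn r ∘ (π ⟨$⟩ʳ_)) ≡ (t ∸ 1) ⊓ n
    entries = trans (sum-cong-≗ (λ j → 𝟙-site< (suc (toℕ j)) t (chip-entry j)))
                    (trans (sum≡∑< {n} (λ j → 𝟙 (suc j ℕ.<? t))) (count t))
      where
      count : ∀ t → ∑< n (λ j → 𝟙 (suc j ℕ.<? t)) ≡ (t ∸ 1) ⊓ n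
      count zero    = ∑<-zero n (λ j _ → 𝟙-no (λ ()) (suc j ℕ.<? 0))
      count (suc t) = trans (∑<-cong n (λ j _ → 𝟙-cong (mk⇔ ℕ.≤-pred s≤s) _ _)) (∑<-below n t)

  tight-initial⇔ : ∀ t → t ≤ n → suc t ≤ #left c₀ (suc t) ⇔ A ≤ t
  tight-initial⇔ t t≤n rewrite #left-initial (suc t) | ℕ.m≤n⇒m⊓n≡m t≤n with A ℕ.<? suc t
  ... | yes A<1+t = mk⇔ (λ _ → ℕ.≤-pred A<1+t) (λ _ → ℕ.≤-refl)
  ... | no A≮1+t  = mk⇔ (λ 1+t≤t → contradiction 1+t≤t (ℕ.<-irrefl refl)) (λ A≤t → contradiction (s≤s A≤t) A≮1+t)

  initial-admissible : Admissible (suc H) c₀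
  initial-admissible = record { inside = inside ; left-lower = lower ; left-upper = upper ; tight = tight }
    where
    inside : ∀ α → - + A ℤ.≤ lookup c₀ α × lookup c₀ α ℤ.≤ site (suc n)
    inside α with chips α
    ... | inj₁ refl      = site-inside A (ℕ.m≤n⇒m≤1+n A≤n) chip-r
    ... | inj₂ (j , refl) = site-inside (suc (toℕ j)) (s≤s (ℕ.<⇒≤ (Fin.toℕ<n j))) (chip-entry j)

    upper : ∀ t → #left c₀ t ≤ t
    upper zero    = ℕ.≤-reflexive (trans (#left-initial 0) (trans (ℕ.+-identityʳ _) (𝟙-no (λ ()) (A ℕ.<? 0))))
    upper (suc t) = subst (_≤ suc t) (sym (#left-initial (suc t))) (ℕ.+-mono-≤ (𝟙≤1 (A ℕ.<? suc t)) (ℕ.m⊓n≤m t n))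

    lower : ∀ t → t ≤ suc (suc n) → t ≤ suc (#left c₀ t)
    lower zero    _ = z≤n
    lower (suc t) t≤ rewrite #left-initial (suc t) with t ℕ.≤? n
    ... | yes t≤n = s≤s (subst (λ k → t ≤ 𝟙 (A ℕ.<? suc t) + k) (sym (ℕ.m≤n⇒m⊓n≡m t≤n)) (ℕ.m≤n+m t _))
    ... | no t≰n rewrite ℕ.≤-antisym (ℕ.≤-pred t≤) (ℕ.≰⇒> t≰n)
                       | ℕ.m≥n⇒m⊓n≡n (ℕ.n≤1+n n)
                       | 𝟙-yes (s≤s (ℕ.m≤n⇒m≤1+n A≤n)) (A ℕ.<? suc (suc n)) = ℕ.≤-refl

    tight : #tight c₀ ≡ suc H
    tight = cong₂ _+_ (𝟙-yes z≤n (0 ℕ.≤? #left c₀ 0))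
      (trans (∑<-cong (suc n) {f = λ t → 𝟙 (suc t ℕ.≤? #left c₀ (suc t))} {g = λ t → 𝟙 (A ℕ.≤? t)}
                (λ t t<1+n → 𝟙-cong (tight-initial⇔ t (ℕ.≤-pred t<1+n)) _ _))
      (trans (∑<-atLeast (suc n) A)
             (trans (cong (_∸ A) (sym A+H≡1+n)) (ℕ.m+n∸m≡n A H))))

proposition2p1 : (n : ℕ) → 2 ≤ n → (π : Permutation′ n) → (r : Fin (suc n)) →
    (c₀ : Config (suc n)) → IsInitial n π r c₀ →
      Acc (λ c' c → Step c c') c₀
      × (∀ c₁ c₂ → Reachable c₀ c₁ → Stable c₁ → Reachable c₀ c₂ → Stable c₂ → c₁ ≡ c₂)
      × (∀ c → Reachable c₀ c → ∀ (α : Fin (suc n)) → InL n (lookup c α))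
      × (∀ c → Reachable c₀ c → Stable c →
           (∀ (α : Fin (suc n)) → lookup c α ≢ hole n)
           × (∀ (x : ℤ) → InL n x → x ≢ hole n →
                ∃[ α ] ((lookup c α ≡ x) × (∀ β → lookup c β ≡ x → β ≡ α))))
proposition2p1 n 2≤n π r c₀ initial =
    good-accessible adm₀
  , (λ _ _ reach₁ stable₁ reach₂ stable₂ →
       normal-form-unique local-confluence adm₀ reach₁ (stable⇒normal stable₁) reach₂ (stable⇒normal stable₂))
  , (λ c reach α → let lo≤ , ≤top = Admissible.inside (good-reachable adm₀ reach) α
                   in lo≤ , subst (lookup c α ℤ.≤_) top-site ≤top)
  , λ c reach stable → let open StableConfiguration (good-reachable adm₀ reach) stable H≤1+n in
      (λ α at-hole → hole-empty α (trans at-hole hole-site))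
    , λ x (lo≤x , x≤top) x≢hole →
        let t , t≤ , x≡ = site-surjective x lo≤x (subst (x ℤ.≤_) (sym top-site) x≤top)
            α , at , unique = unique-chip t t≤ (λ t≡H → x≢hole (trans x≡ (trans (cong site t≡H) (sym hole-site))))
        in α , trans at (sym x≡) , λ β at-x → unique β (trans at-x x≡)
  where
  open Initial n (ℕ.≤-trans (s≤s z≤n) 2≤n) π r c₀ initial
  open Chips (suc n) (- + A)
  open InvariantRewriting Step (Admissible (suc H)) step-admissible Ψ Ψ-step
  adm₀ : Admissible (suc H) c₀
  adm₀ = initial-admissible
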